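{- Let $d,k$ be positive integers. There are only finitely many isomorphism classes of loopless matroids $M$ of rank $d$ whose independence complex $\mathcal{I}(M)$ satisfies $h_d(\mathcal{I}(M))=k$.
   Context: For a matroid $M$ on ground set $E$, the independence complex $\mathcal{I}(M)$ is the simplicial complex on $E$ whose faces are the independent sets of $M$; if $M$ has rank $d$ it has dimension $d-1$. A loop is an element $x$ with $r(\{x\})=0$; $M$ is loopless if it has none. For a $(d-1)$-dimensional simplicial complex $\Delta$ with $f_{i}$ faces of dimension $i$ (so $f_{ -1}=1$), the $h$-vector $(h_0,\dots,h_d)$ is defined by $\sum_{i=0}^d h_i t^i=\sum_{i=0}^d f_{i-1}t^i(1-t)^{d-i}$. -}

module Defs where

open import Data.Bool using (Bool; true; false)
open import Data.Nat using (ℕ; zero; suc; _≤_; _<_)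
open import Data.Integer using (ℤ; +_; _-_)
open import Data.Fin using (Fin)
open import Data.Fin.Subset using (Subset; ⁅_⁆; _∈_; _∉_; _⊆_; _∪_; ∣_∣)
  renaming (⊥ to ∅)
open import Data.Vec using (Vec; []; _∷_; lookup; tabulate)
open import Data.List using (List; []; _∷_; _++_; map; filter; length)
open import Data.Product using (Σ; ∃; _×_; _,_)
open import Relation.Binary.PropositionalEquality using (_≡_)
open import Relation.Nullary using (Dec; yes; no)
open import Data.Bool using (_≟_) renaming (_∧_ to _and_)
open import Data.Nat using () renaming (_≡ᵇ_ to _==_)
open import Function.Bundles using (_↔_; Inverse)

record Matroid (n : ℕ) : Set where
  field
    indep       : Subset n → Bool
    indep-empty : indep ∅ ≡ true
    indep-down  : ∀ {S T} → S ⊆ T → indep T ≡ true → indep S ≡ true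
    indep-exch  : ∀ {S T} → indep S ≡ true → indep T ≡ true → ∣ S ∣ < ∣ T ∣ →
                  ∃ λ x → x ∈ T × x ∉ S × indep (S ∪ ⁅ x ⁆) ≡ true
open Matroid public

HasRank : ∀ {n} → Matroid n → ℕ → Set
HasRank M d = (∃ λ S → indep M S ≡ true × ∣ S ∣ ≡ d)
            × (∀ S → indep M S ≡ true → ∣ S ∣ ≤ d)

Loopless : ∀ {n} → Matroid n → Set
Loopless {n} M = ∀ (x : Fin n) → indep M ⁅ x ⁆ ≡ true

allSubsets : ∀ n → List (Subset n)
allSubsets zero    = [] ∷ []
allSubsets (suc n) = map (false ∷_) (allSubsets n) ++ map (true ∷_) (allSubsets n)

-- f_{i-1}(I(M)) : number of independent sets of cardinality i.
fvec : ∀ {n} → Matroid n → ℕ → ℕ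
fvec {n} M i = length (filter (λ S → (indep M S and (∣ S ∣ == i)) ≟ true) (allSubsets n))

-- h_d of a (d-1)-dimensional complex: coefficient of t^d in
-- Σ_{i=0}^d f_{i-1} t^i (1-t)^{d-i}, i.e. Σ_{i=0}^d (-1)^{d-i} f_{i-1}.
-- hTop M d j = Σ_{i=0}^{j} (-1)^{j-i} f_{i-1}, computed by recursion on j.
hTopAux : ∀ {n} → Matroid n → ℕ → ℤ
hTopAux M zero    = + fvec M 0
hTopAux M (suc j) = + fvec M (suc j) - hTopAux M j

hTop : ∀ {n} → Matroid n → (d : ℕ) → ℤ
hTop M d = hTopAux M d

preimage : ∀ {n m} → (Fin n → Fin m) → Subset m → Subset n
preimage σ S = tabulate (λ i → lookup S (σ i))

_≅_ : ∀ {n m} → Matroid n → Matroid m → Set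
_≅_ {n} {m} M N = Σ (Fin n ↔ Fin m) λ σ →
  ∀ (S : Subset m) → indep N S ≡ indep M (preimage (Inverse.to σ) S)

SomeMatroid : Set
SomeMatroid = Σ ℕ Matroid

module Submission where

-- For a matroid M of rank d write h(M) for the top h-number h_d of its independence
-- complex, the alternating sum Σ_{i ≤ d} (-1)^{d-i} f_{i-1}.  Splitting the independent
-- sets according to whether they contain the element 0 yields the deletion–contraction
-- recursion h(M) = h(M∖0) + h(M/0) when 0 is not a loop, and h(M) = h(M∖0) when it is.
-- Induction on the size of the ground set then gives:
--   (1) if M has a coloop, then h(M) = 0 (the complex is a cone);
--   (2) if M has no coloop, then h(M) = 1 + c where #(non-loops of M) ≤ c + 2d.
-- In (2) the only delicate case is when M∖0 acquires a coloop x: then h(M∖0) = 0 by (1),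
-- and every non-loop of M∖0 other than x is a non-loop of M/0.
-- For a loopless M with h(M) = k ≥ 1, (1) excludes coloops and (2) bounds the size of the
-- ground set by k + 2d.  Finally, every matroid on at most N elements is isomorphic to a
-- member of an explicit finite catalogue: run through all set families on Fin m, m ≤ N,
-- and keep those that satisfy the matroid axioms.

open import Defs
open import Data.Bool using (Bool; true; false; T; if_then_else_) renaming (_∧_ to _and_)
open import Data.Bool.Properties using () renaming (_≟_ to _≟ᵇ_)
open import Data.Nat using (ℕ; zero; suc; _≤_; _<_; _+_; _∸_; z≤n; s≤s; _<?_)
  renaming (_≡ᵇ_ to _==_; _≟_ to _≟ℕ_)
open import Data.Nat.Properties
  using (≤-reflexive; m≤n⇒m≤1+n; n≤1+n; +-suc; +-identityʳ; +-monoˡ-≤;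
         suc-injective; ≤-pred; m<m+n; m+[n∸m]≡n; ≡ᵇ⇒≡; module ≤-Reasoning)
open import Data.Nat.Tactic.RingSolver using () renaming (solve-∀ to solveℕ)
open import Data.Integer using (ℤ; +_) renaming (_+_ to _+ℤ_; _-_ to _-ℤ_)
open import Data.Integer.Properties using (+-injective; +-identityˡ)
open import Data.Integer.Tactic.RingSolver using () renaming (solve-∀ to solveℤ)
open import Data.Fin using (Fin; zero; suc) renaming (_≟_ to _≟ᶠ_)
open import Data.Fin.Properties using (all?; any?; ¬∀⟶∃¬) renaming (suc-injective to suc-injectiveᶠ)
open import Data.Fin.Subset using (Subset; ∣_∣; _∈_; _∉_; _⊆_; _∪_; ⁅_⁆; ⊤) renaming (⊥ to ∅)
open import Data.Fin.Subset.Properties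
  using (_∈?_; _⊆?_; anySubset?; drop-there; drop-∷-⊆; s⊆s; out⊆; ∉⊥; ∪-identityʳ;
         p⊆p∪q; x∈p∪q⁺; x∈p∪q⁻; x∈⁅x⁆; x∈⁅y⁆⇒x≡y; p⊆q⇒∣p∣≤∣q∣; ∣⊤∣≡n)
open import Data.Vec using (_∷_; []; tabulate; here; there)
open import Data.Vec.Properties using (lookup∘tabulate; tabulate∘lookup; []=⇒lookup; lookup⇒[]=)
open import Data.List using (List; []; _∷_; _++_; map; filter; length; concatMap; mapMaybe;
                             upTo; cartesianProductWith)
open import Data.List.Relation.Unary.Any using (Any; here; there) renaming (map to anyMap)
open import Data.List.Relation.Unary.Any.Properties
  using (map⁺; concatMap⁺; mapMaybe⁺; cartesianProductWith⁺; applyUpTo⁺)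
open import Data.Maybe using (Maybe; just; nothing)
open import Data.Maybe.Relation.Unary.Any using (just) renaming (Any to MaybeAny)
open import Data.Product using (Σ; ∃; _×_; _,_; proj₁; proj₂)
open import Data.Sum using (_⊎_; inj₁; inj₂)
open import Data.Empty using (⊥-elim)
open import Data.Unit using (tt)
open import Function using (const)
open import Function.Properties.Inverse using (↔-refl)
open import Relation.Binary.PropositionalEquality
open import Relation.Nullary using (Dec; yes; no; ¬_)
open import Relation.Nullary.Decidable using (_×-dec_; _→-dec_; ¬?; decidable-stable)
open import Relation.Unary using (Decidable)

count : ∀ {A : Set} → (A → Bool) → List A → ℕ
count p []       = 0
count p (x ∷ xs) = if p x then suc (count p xs) else count p xs

length-filter≡count : ∀ {A : Set} (p : A → Bool) xs →
                      length (filter (λ x → p x ≟ᵇ true) xs) ≡ count p xs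
length-filter≡count p [] = refl
length-filter≡count p (x ∷ xs) with p x
... | true  = cong suc (length-filter≡count p xs)
... | false = length-filter≡count p xs

count-++ : ∀ {A : Set} (p : A → Bool) xs ys → count p (xs ++ ys) ≡ count p xs + count p ys
count-++ p [] ys = refl
count-++ p (x ∷ xs) ys with p x
... | true  = cong suc (count-++ p xs ys)
... | false = count-++ p xs ys

count-map : ∀ {A B : Set} (p : B → Bool) (g : A → B) xs → count p (map g xs) ≡ count (λ x → p (g x)) xs
count-map p g [] = refl
count-map p g (x ∷ xs) with p (g x)
... | true  = cong suc (count-map p g xs)
... | false = count-map p g xs

count-cong : ∀ {A : Set} {p q : A → Bool} → (∀ x → p x ≡ q x) → ∀ xs → count p xs ≡ count q xs
count-cong e [] = refl
count-cong {q = q} e (x ∷ xs) rewrite e x with q x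
... | true  = cong suc (count-cong e xs)
... | false = count-cong e xs

count-none : ∀ {A : Set} {p : A → Bool} → (∀ x → p x ≡ false) → ∀ xs → count p xs ≡ 0
count-none e [] = refl
count-none e (x ∷ xs) rewrite e x = count-none e xs

Family : ℕ → Set
Family n = Subset n → Bool

faces : ∀ {n} → Family n → ℕ → ℕ
faces {n} F i = count (λ S → F S and (∣ S ∣ == i)) (allSubsets n)

hAlt : ∀ {n} → Family n → ℕ → ℤ
hAlt F zero    = + faces F 0
hAlt F (suc j) = + faces F (suc j) -ℤ hAlt F j

hTop≡hAlt : ∀ {n} (M : Matroid n) j → hTopAux M j ≡ hAlt (indep M) j
hTop≡hAlt {n} M zero = cong +_ (length-filter≡count _ (allSubsets n))
hTop≡hAlt {n} M (suc j) =
  cong₂ (λ a b → + a -ℤ b) (length-filter≡count _ (allSubsets n)) (hTop≡hAlt M j)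

faces-cong : ∀ {n} {F G : Family n} → (∀ S → F S ≡ G S) → ∀ i → faces F i ≡ faces G i
faces-cong {n} e i = count-cong (λ S → cong (_and (∣ S ∣ == i)) (e S)) (allSubsets n)

hAlt-cong : ∀ {n m} (F : Family n) (G : Family m) → (∀ i → faces F i ≡ faces G i) →
            ∀ j → hAlt F j ≡ hAlt G j
hAlt-cong F G e zero    = cong +_ (e 0)
hAlt-cong F G e (suc j) = cong₂ (λ a b → + a -ℤ b) (e (suc j)) (hAlt-cong F G e j)

deletion₀ link₀ : ∀ {n} → Family (suc n) → Family n
deletion₀ F S = F (false ∷ S)
link₀     F S = F (true ∷ S)

module _ {n : ℕ} (F : Family (suc n)) where

  -- Every subset of Fin (suc n) is counted once, through the deletion or through the link.
  faces-suc : ∀ i → faces F (suc i) ≡ faces (deletion₀ F) (suc i) + faces (link₀ F) i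
  faces-suc i = trans (count-++ p (map (false ∷_) A) (map (true ∷_) A))
                      (cong₂ _+_ (count-map p (false ∷_) A) (count-map p (true ∷_) A))
    where
      A = allSubsets n
      p = λ S → F S and (∣ S ∣ == suc i)

  faces-zero : faces F 0 ≡ faces (deletion₀ F) 0
  faces-zero =
    begin
      count p (map (false ∷_) A ++ map (true ∷_) A)
    ≡⟨ count-++ p (map (false ∷_) A) (map (true ∷_) A) ⟩
      count p (map (false ∷_) A) + count p (map (true ∷_) A)
    ≡⟨ cong₂ _+_ (count-map p (false ∷_) A)
                 (trans (count-map p (true ∷_) A) (count-none (λ S → and-false (F (true ∷ S))) A)) ⟩
      faces (deletion₀ F) 0 + 0
    ≡⟨ +-identityʳ _ ⟩
      faces (deletion₀ F) 0
    ∎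
    where
      open ≡-Reasoning
      A = allSubsets n
      p = λ S → F S and (∣ S ∣ == 0)
      and-false : ∀ b → (b and false) ≡ false
      and-false true  = refl
      and-false false = refl

  hAlt-split : ∀ j → hAlt F (suc j) ≡ hAlt (deletion₀ F) (suc j) +ℤ hAlt (link₀ F) j
  hAlt-split zero =
    trans (cong₂ (λ a b → + a -ℤ + b) (faces-suc 0) faces-zero)
          (regroup (+ faces (deletion₀ F) 1) (+ faces (link₀ F) 0) (+ faces (deletion₀ F) 0))
    where
      regroup : ∀ (a b c : ℤ) → (a +ℤ b) -ℤ c ≡ (a -ℤ c) +ℤ b
      regroup = solveℤ
  hAlt-split (suc j) =
    trans (cong₂ (λ a b → + a -ℤ b) (faces-suc (suc j)) (hAlt-split j))
          (interchange (+ faces (deletion₀ F) (suc (suc j))) (+ faces (link₀ F) (suc j))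
                       (hAlt (deletion₀ F) (suc j)) (hAlt (link₀ F) j))
    where
      interchange : ∀ (a b c e : ℤ) → (a +ℤ b) -ℤ (c +ℤ e) ≡ (a -ℤ c) +ℤ (b -ℤ e)
      interchange = solveℤ

  hAlt-emptyLink : (∀ S → link₀ F S ≡ false) → ∀ j → hAlt F j ≡ hAlt (deletion₀ F) j
  hAlt-emptyLink empty = hAlt-cong F (deletion₀ F) same
    where
      same : ∀ i → faces F i ≡ faces (deletion₀ F) i
      same zero    = faces-zero
      same (suc i) = trans (faces-suc i)
        (trans (cong (λ m → faces (deletion₀ F) (suc i) + m)
                     (count-none (λ S → cong (_and (∣ S ∣ == i)) (empty S)) (allSubsets n)))
               (+-identityʳ _))

  hAlt-cone : (∀ S → deletion₀ F S ≡ link₀ F S) → ∀ j → faces (deletion₀ F) (suc j) ≡ 0 →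
              hAlt F (suc j) ≡ + 0
  hAlt-cone cone j noTop =
    begin
      hAlt F (suc j)
    ≡⟨ hAlt-split j ⟩
      (+ faces (deletion₀ F) (suc j) -ℤ hAlt (deletion₀ F) j) +ℤ hAlt (link₀ F) j
    ≡⟨ cong₂ (λ a b → (+ a -ℤ b) +ℤ hAlt (link₀ F) j) noTop
             (hAlt-cong (deletion₀ F) (link₀ F) (faces-cong cone) j) ⟩
      (+ 0 -ℤ hAlt (link₀ F) j) +ℤ hAlt (link₀ F) j
    ≡⟨ cancel (hAlt (link₀ F) j) ⟩
      + 0
    ∎
    where
      open ≡-Reasoning
      cancel : ∀ (x : ℤ) → (+ 0 -ℤ x) +ℤ x ≡ + 0
      cancel = solveℤ

-- Membership in bases is decidable,
-- so every element is a coloop or avoidable.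

Basis : ∀ {n} → Matroid n → ℕ → Subset n → Set
Basis M d B = indep M B ≡ true × ∣ B ∣ ≡ d

Coloop : ∀ {n} → Matroid n → ℕ → Fin n → Set
Coloop M d x = ∀ B → Basis M d B → x ∈ B

Avoidable : ∀ {n} → Matroid n → ℕ → Fin n → Set
Avoidable M d x = ∃ λ B → Basis M d B × x ∉ B

ColoopFree : ∀ {n} → Matroid n → ℕ → Set
ColoopFree M d = ∀ x → Avoidable M d x

avoidable? : ∀ {n} (M : Matroid n) d x → Dec (Avoidable M d x)
avoidable? M d x = anySubset? (λ B → ((indep M B ≟ᵇ true) ×-dec (∣ B ∣ ≟ℕ d)) ×-dec ¬? (x ∈? B))

unavoidable⇒coloop : ∀ {n} (M : Matroid n) d x → ¬ Avoidable M d x → Coloop M d x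
unavoidable⇒coloop M d x ¬a B b = decidable-stable (x ∈? B) (λ x∉B → ¬a (B , b , x∉B))

coloop-or-avoidable : ∀ {n} (M : Matroid n) d x → Coloop M d x ⊎ Avoidable M d x
coloop-or-avoidable M d x with avoidable? M d x
... | yes a  = inj₂ a
... | no ¬a = inj₁ (unavoidable⇒coloop M d x ¬a)

coloop-or-free : ∀ {n} (M : Matroid n) d → (∃ λ x → Coloop M d x) ⊎ ColoopFree M d
coloop-or-free {n} M d with all? (avoidable? M d)
... | yes free = inj₂ free
... | no ¬free with ¬∀⟶∃¬ n _ (avoidable? M d) ¬free
...   | x , ¬a = inj₁ (x , unavoidable⇒coloop M d x ¬a)

∣p∪⁅x⁆∣≡1+∣p∣ : ∀ {n} (p : Subset n) x → x ∉ p → ∣ p ∪ ⁅ x ⁆ ∣ ≡ suc ∣ p ∣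
∣p∪⁅x⁆∣≡1+∣p∣ (true  ∷ p) zero    x∉p = ⊥-elim (x∉p here)
∣p∪⁅x⁆∣≡1+∣p∣ (false ∷ p) zero    x∉p = cong (λ q → suc ∣ q ∣) (∪-identityʳ p)
∣p∪⁅x⁆∣≡1+∣p∣ (true  ∷ p) (suc y) x∉p = cong suc (∣p∪⁅x⁆∣≡1+∣p∣ p y (λ y∈p → x∉p (there y∈p)))
∣p∪⁅x⁆∣≡1+∣p∣ (false ∷ p) (suc y) x∉p = ∣p∪⁅x⁆∣≡1+∣p∣ p y (λ y∈p → x∉p (there y∈p))

∣p∪⁅x⁆∣≤1+∣p∣ : ∀ {n} (p : Subset n) x → ∣ p ∪ ⁅ x ⁆ ∣ ≤ suc ∣ p ∣
∣p∪⁅x⁆∣≤1+∣p∣ p x with x ∈? p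
... | no x∉p  = ≤-reflexive (∣p∪⁅x⁆∣≡1+∣p∣ p x x∉p)
... | yes x∈p = m≤n⇒m≤1+n (p⊆q⇒∣p∣≤∣q∣ absorb)
  where
    absorb : p ∪ ⁅ x ⁆ ⊆ p
    absorb y∈ with x∈p∪q⁻ p ⁅ x ⁆ y∈
    ... | inj₁ y∈p  = y∈p
    ... | inj₂ y∈⁅x⁆ = subst (_∈ p) (sym (x∈⁅y⁆⇒x≡y x y∈⁅x⁆)) x∈p

augment : ∀ {n} (M : Matroid n) m {S T} → indep M S ≡ true → indep M T ≡ true → ∣ S ∣ + m ≡ ∣ T ∣ →
          ∃ λ U → indep M U ≡ true × S ⊆ U × U ⊆ S ∪ T × ∣ U ∣ ≡ ∣ T ∣
augment M zero {S} {T} iS iT size = S , iS , (λ s → s) , p⊆p∪q T , trans (sym (+-identityʳ _)) size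
augment M (suc m) {S} {T} iS iT size with indep-exch M iS iT S<T
  where
    S<T : ∣ S ∣ < ∣ T ∣
    S<T = subst (∣ S ∣ <_) size (m<m+n ∣ S ∣ (s≤s z≤n))
... | x , x∈T , x∉S , iSx
  with augment M m iSx iT (trans (cong (_+ m) (∣p∪⁅x⁆∣≡1+∣p∣ S x x∉S)) (trans (sym (+-suc ∣ S ∣ m)) size))
...   | U , iU , Sx⊆U , U⊆ , sizeU = U , iU , (λ s → Sx⊆U (p⊆p∪q ⁅ x ⁆ s)) , within , sizeU
  where
    within : U ⊆ S ∪ T
    within u with x∈p∪q⁻ (S ∪ ⁅ x ⁆) T (U⊆ u)
    ... | inj₂ u∈T = x∈p∪q⁺ (inj₂ u∈T)
    ... | inj₁ u∈Sx with x∈p∪q⁻ S ⁅ x ⁆ u∈Sx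
    ...   | inj₁ u∈S  = x∈p∪q⁺ (inj₁ u∈S)
    ...   | inj₂ u∈⁅x⁆ = x∈p∪q⁺ (inj₂ (subst (_∈ T) (sym (x∈⁅y⁆⇒x≡y _ u∈⁅x⁆)) x∈T))

extend-to-basis : ∀ {n} (M : Matroid n) {d S B} → HasRank M d → Basis M d B → indep M S ≡ true →
                  ∃ λ U → Basis M d U × S ⊆ U × U ⊆ S ∪ B
extend-to-basis M {d} {S} {B} hr (iB , sB) iS
  with augment M (d ∸ ∣ S ∣) iS iB (trans (m+[n∸m]≡n (proj₂ hr S iS)) (sym sB))
... | U , iU , S⊆U , U⊆ , sU = U , (iU , trans sU sB) , S⊆U , U⊆

deletion : ∀ {n} → Matroid (suc n) → Matroid n
deletion M = record
  { indep       = deletion₀ (indep M)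
  ; indep-empty = indep-empty M
  ; indep-down  = λ S⊆T → indep-down M (s⊆s S⊆T)
  ; indep-exch  = λ iS iT lt → shift (indep-exch M iS iT lt)
  }
  where
    shift : ∀ {S T} → (∃ λ x → x ∈ false ∷ T × x ∉ false ∷ S × indep M ((false ∷ S) ∪ ⁅ x ⁆) ≡ true) →
            ∃ λ y → y ∈ T × y ∉ S × indep M (false ∷ (S ∪ ⁅ y ⁆)) ≡ true
    shift (suc y , y∈T , y∉S , i) = y , drop-there y∈T , (λ y∈S → y∉S (there y∈S)) , i

contraction : ∀ {n} (M : Matroid (suc n)) → indep M ⁅ zero ⁆ ≡ true → Matroid n
contraction M nonloop = record
  { indep       = link₀ (indep M)
  ; indep-empty = nonloop
  ; indep-down  = λ S⊆T → indep-down M (s⊆s S⊆T)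
  ; indep-exch  = λ iS iT lt → shift (indep-exch M iS iT (s≤s lt))
  }
  where
    shift : ∀ {S T} → (∃ λ x → x ∈ true ∷ T × x ∉ true ∷ S × indep M ((true ∷ S) ∪ ⁅ x ⁆) ≡ true) →
            ∃ λ y → y ∈ T × y ∉ S × indep M (true ∷ (S ∪ ⁅ y ⁆)) ≡ true
    shift (zero  , _   , 0∉S , _) = ⊥-elim (0∉S here)
    shift (suc y , y∈T , y∉S , i) = y , drop-there y∈T , (λ y∈S → y∉S (there y∈S)) , i

module _ {n : ℕ} (M : Matroid (suc n)) where

  avoid-zero : ∀ {d} → Avoidable M d zero → ∃ (Basis (deletion M) d)
  avoid-zero (true  ∷ B , _ , 0∉B) = ⊥-elim (0∉B here)
  avoid-zero (false ∷ B , b , _)   = B , b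

  deletion-rank : ∀ {d} → HasRank M d → ∃ (Basis (deletion M) d) → HasRank (deletion M) d
  deletion-rank hr b = b , λ S iS → proj₂ hr (false ∷ S) iS

  nonloop⇒rank-suc : ∀ {d} → HasRank M d → indep M ⁅ zero ⁆ ≡ true → ∃ λ d' → d ≡ suc d'
  nonloop⇒rank-suc {zero} hr nonloop with proj₂ hr ⁅ zero ⁆ nonloop
  ... | ()
  nonloop⇒rank-suc {suc d'} hr nonloop = d' , refl

  loop-or-nonloop : indep M ⁅ zero ⁆ ≡ false ⊎ indep M ⁅ zero ⁆ ≡ true
  loop-or-nonloop with indep M ⁅ zero ⁆
  ... | false = inj₁ refl
  ... | true  = inj₂ refl

  loop⇒emptyLink : indep M ⁅ zero ⁆ ≡ false → ∀ S → link₀ (indep M) S ≡ false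
  loop⇒emptyLink loop S with indep M (true ∷ S) in iS
  ... | false = refl
  ... | true  = trans (sym (indep-down M ⁅0⁆⊆ iS)) loop
    where
      ⁅0⁆⊆ : ⁅ zero ⁆ ⊆ true ∷ S
      ⁅0⁆⊆ here        = here
      ⁅0⁆⊆ (there y∈∅) = ⊥-elim (∉⊥ y∈∅)

  module _ (nonloop : indep M ⁅ zero ⁆ ≡ true) where

    -- Extending {0} inside a basis B of M gives a basis of M/0 whose lift lies in B.
    contraction-basis : ∀ {d B} → HasRank M (suc d) → Basis M (suc d) B →
                        ∃ λ U → Basis (contraction M nonloop) d U × (∀ {y} → y ∈ U → suc y ∈ B)
    contraction-basis hr b with extend-to-basis M hr b nonloop
    ... | true ∷ U , (iU , sU) , _ , U⊆ = U , (iU , suc-injective sU) , inB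
      where
        inB : ∀ {y} → y ∈ U → suc y ∈ _
        inB y∈U with x∈p∪q⁻ ⁅ zero ⁆ _ (U⊆ (there y∈U))
        ... | inj₁ (there y∈∅) = ⊥-elim (∉⊥ y∈∅)
        ... | inj₂ y∈B        = y∈B
    ... | false ∷ U , _ , ⁅0⁆⊆U , _ with ⁅0⁆⊆U here
    ...   | ()

    contraction-rank : ∀ {d} → HasRank M (suc d) → HasRank (contraction M nonloop) d
    contraction-rank hr with contraction-basis hr (proj₂ (proj₁ hr))
    ... | U , b , _ = (U , b) , λ S iS → ≤-pred (proj₂ hr (true ∷ S) iS)

    contraction-free : ∀ {d} → HasRank M (suc d) → ColoopFree M (suc d) →
                       ColoopFree (contraction M nonloop) d
    contraction-free hr free x with free (suc x)
    ... | B , b , x∉B with contraction-basis hr b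
    ...   | U , bU , inB = U , bU , λ x∈U → x∉B (inB x∈U)

    coloop-contraction : ∀ {d y} → Coloop M (suc d) (suc y) → Coloop (contraction M nonloop) d y
    coloop-contraction c B (iB , sB) = drop-there (c (true ∷ B) (iB , cong suc sB))

  coloop-deletion : ∀ {d y} → Coloop M d (suc y) → Coloop (deletion M) d y
  coloop-deletion c B b = drop-there (c (false ∷ B) b)

  loop-deletion-free : ∀ {d} → indep M ⁅ zero ⁆ ≡ false → ColoopFree M d → ColoopFree (deletion M) d
  loop-deletion-free loop free x with free (suc x)
  ... | false ∷ B , b , x∉B = B , b , λ x∈B → x∉B (there x∈B)
  ... | true  ∷ B , (iB , _) , _ with trans (sym iB) (loop⇒emptyLink loop B)
  ...   | ()

  coloop-cone : ∀ {d} → HasRank M d → Coloop M d zero → ∀ S → deletion₀ (indep M) S ≡ link₀ (indep M) S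
  coloop-cone hr c S with indep M (false ∷ S) in i₀ | indep M (true ∷ S) in i₁
  ... | false | false = refl
  ... | true  | true  = refl
  ... | false | true  = trans (sym i₀) (indep-down M (out⊆ (λ s → s)) i₁)
  ... | true  | false with extend-to-basis M hr (proj₂ (proj₁ hr)) i₀
  ...   | U , b@(iU , _) , S⊆U , _ = trans (sym (indep-down M S⊆U′ iU)) i₁
    where
      S⊆U′ : true ∷ S ⊆ U
      S⊆U′ here      = c U b
      S⊆U′ (there s) = S⊆U (there s)

  coloop-noTop : ∀ {d} → Coloop M d zero → faces (deletion₀ (indep M)) d ≡ 0
  coloop-noTop {d} c = count-none noBasis (allSubsets n)
    where
      noBasis : ∀ S → (indep M (false ∷ S) and (∣ S ∣ == d)) ≡ false
      noBasis S with indep M (false ∷ S) in iS | ∣ S ∣ == d in sS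
      ... | false | _     = refl
      ... | true  | false = refl
      ... | true  | true with c (false ∷ S) (iS , ≡ᵇ⇒≡ ∣ S ∣ d (subst T (sym sS) tt))
      ...   | ()

-- When the coloop is 0, a basis through 0 shows d = 1 + ∣B∣ and the cone lemmas apply.
cone-h≡0 : ∀ {n} (M : Matroid (suc n)) {d} → HasRank M d → Coloop M d zero → hAlt (indep M) d ≡ + 0
cone-h≡0 M hr c with proj₁ hr
... | false ∷ B , b with c (false ∷ B) b
...   | ()
cone-h≡0 M hr c | true ∷ B , (_ , refl) = hAlt-cone (indep M) (coloop-cone M hr c) ∣ B ∣ (coloop-noTop M c)

-- Otherwise some basis avoids 0, so M∖0 still has rank d and inherits the coloop, as does
-- M/0 when 0 is not a loop; conclude by the deletion–contraction recursion.
coloop⇒h≡0 : ∀ {n} (M : Matroid n) {d} → HasRank M d → ∀ x → Coloop M d x → hAlt (indep M) d ≡ + 0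
coloop⇒h≡0 {zero} M hr () c
coloop⇒h≡0 {suc n} M {d} hr x c with coloop-or-avoidable M d zero
... | inj₁ c₀ = cone-h≡0 M hr c₀
... | inj₂ a with avoid-zero M a | x
...   | B , b | zero with c (false ∷ B) b
...     | ()
coloop⇒h≡0 {suc n} M {d} hr x c | inj₂ a | B , b | suc y with loop-or-nonloop M
... | inj₁ i₀ = trans (hAlt-emptyLink (indep M) (loop⇒emptyLink M i₀) d)
                    (coloop⇒h≡0 (deletion M) (deletion-rank M hr (B , b)) y (coloop-deletion M c))
... | inj₂ i₀ with nonloop⇒rank-suc M hr i₀
...   | d' , refl = trans (hAlt-split (indep M) d') (cong₂ _+ℤ_
          (coloop⇒h≡0 (deletion M) (deletion-rank M hr (B , b)) y (coloop-deletion M c))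
          (coloop⇒h≡0 (contraction M i₀) (contraction-rank M i₀ hr) y (coloop-contraction M i₀ c)))

nonloops : ∀ {n} → Matroid n → Subset n
nonloops M = tabulate (λ x → indep M ⁅ x ⁆)

∈nonloops⁺ : ∀ {n} (M : Matroid n) {x} → indep M ⁅ x ⁆ ≡ true → x ∈ nonloops M
∈nonloops⁺ M {x} i = lookup⇒[]= x _ (trans (lookup∘tabulate _ x) i)

∈nonloops⁻ : ∀ {n} (M : Matroid n) {x} → x ∈ nonloops M → indep M ⁅ x ⁆ ≡ true
∈nonloops⁻ M {x} x∈ = trans (sym (lookup∘tabulate _ x)) ([]=⇒lookup x∈)

∣nonloops∣-loop : ∀ {n} (M : Matroid (suc n)) → indep M ⁅ zero ⁆ ≡ false →
                  ∣ nonloops M ∣ ≡ ∣ nonloops (deletion M) ∣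
∣nonloops∣-loop M loop = cong (λ b → ∣ b ∷ nonloops (deletion M) ∣) loop

∣nonloops∣-nonloop : ∀ {n} (M : Matroid (suc n)) → indep M ⁅ zero ⁆ ≡ true →
                     ∣ nonloops M ∣ ≡ suc ∣ nonloops (deletion M) ∣
∣nonloops∣-nonloop M nonloop = cong (λ b → ∣ b ∷ nonloops (deletion M) ∣) nonloop

-- In a coloop-free M of rank d+1 with 0 not a loop, if x is a coloop of M∖0 then every
-- other non-loop z of M∖0 stays a non-loop of M/0: a basis through z, built from a basis
-- avoiding x, must contain 0.
nonloops-deletion⊆ : ∀ {n} (M : Matroid (suc n)) (nonloop : indep M ⁅ zero ⁆ ≡ true) {d x} →
  HasRank M (suc d) → ColoopFree M (suc d) → Coloop (deletion M) (suc d) x →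
  nonloops (deletion M) ⊆ nonloops (contraction M nonloop) ∪ ⁅ x ⁆
nonloops-deletion⊆ M nonloop {x = x} hr free cx {z} z∈ with z ≟ᶠ x
... | yes refl = x∈p∪q⁺ (inj₂ (x∈⁅x⁆ z))
... | no z≢x   = x∈p∪q⁺ (inj₁ (∈nonloops⁺ (contraction M nonloop) pair))
  where
    pair : indep M (true ∷ ⁅ z ⁆) ≡ true
    pair with free (suc x)
    ... | B , b , x∉B with extend-to-basis M hr b (∈nonloops⁻ (deletion M) z∈)
    ...   | true ∷ U , (iU , _) , z⊆U , _ = indep-down M (s⊆s (drop-∷-⊆ z⊆U)) iU
    ...   | false ∷ U , b′ , _ , U⊆ with x∈p∪q⁻ ⁅ suc z ⁆ B (U⊆ (there (cx U b′)))
    ...     | inj₁ x∈⁅z⁆ = ⊥-elim (z≢x (sym (suc-injectiveᶠ (x∈⁅y⁆⇒x≡y _ x∈⁅z⁆))))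
    ...     | inj₂ x∈B = ⊥-elim (x∉B x∈B)

-- By induction: if 0 is a loop pass to M∖0; otherwise combine the bounds for M/0 and M∖0,
-- or, when M∖0 has a coloop, the bound for M/0 with the inclusion above.

free⇒h-bound : ∀ {n} (M : Matroid n) {d} → HasRank M d → ColoopFree M d →
               ∃ λ c → hAlt (indep M) d ≡ + suc c × ∣ nonloops M ∣ ≤ c + (d + d)
free⇒h-bound {zero} M hr _ with proj₁ hr
... | [] , _ , refl = 0 , cong (λ b → + (if b and true then 1 else 0)) (indep-empty M) , z≤n
free⇒h-bound {suc n} M {d} hr free with deletion-rank M hr (avoid-zero M (free zero)) | loop-or-nonloop M
... | hrDel | inj₁ i₀ with free⇒h-bound (deletion M) hrDel (loop-deletion-free M i₀ free)
...   | c , h , bound = c , trans (hAlt-emptyLink (indep M) (loop⇒emptyLink M i₀) d) h ,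
                        subst (_≤ c + (d + d)) (sym (∣nonloops∣-loop M i₀)) bound
free⇒h-bound {suc n} M {d} hr free | hrDel | inj₂ i₀ with nonloop⇒rank-suc M hr i₀
... | d' , refl with free⇒h-bound (contraction M i₀) (contraction-rank M i₀ hr) (contraction-free M i₀ hr free)
...   | b , hCon , boundCon with coloop-or-free (deletion M) (suc d')
...     | inj₂ freeDel with free⇒h-bound (deletion M) hrDel freeDel
...       | a , hDel , boundDel =
  a + suc b , trans (hAlt-split (indep M) d') (cong₂ _+ℤ_ hDel hCon) ,
  (begin
     ∣ nonloops M ∣                   ≡⟨ ∣nonloops∣-nonloop M i₀ ⟩
     suc ∣ nonloops (deletion M) ∣    ≤⟨ s≤s boundDel ⟩
     suc a + D                        ≤⟨ +-monoˡ-≤ D (m<m+n a (s≤s z≤n)) ⟩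
     (a + suc b) + D                  ∎)
  where
    open ≤-Reasoning
    D = suc d' + suc d'
free⇒h-bound {suc n} M {d} hr free | hrDel | inj₂ i₀ | d' , refl | b , hCon , boundCon | inj₁ (x , cx) =
  b , trans (hAlt-split (indep M) d')
            (trans (cong (_+ℤ hAlt (link₀ (indep M)) d') (coloop⇒h≡0 (deletion M) hrDel x cx))
                   (trans (+-identityˡ _) hCon)) ,
  (begin
     ∣ nonloops M ∣                                      ≡⟨ ∣nonloops∣-nonloop M i₀ ⟩
     suc ∣ nonloops (deletion M) ∣                       ≤⟨ s≤s (p⊆q⇒∣p∣≤∣q∣ (nonloops-deletion⊆ M i₀ hr free cx)) ⟩
     suc ∣ nonloops (contraction M i₀) ∪ ⁅ x ⁆ ∣         ≤⟨ s≤s (∣p∪⁅x⁆∣≤1+∣p∣ (nonloops (contraction M i₀)) x) ⟩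
     suc (suc ∣ nonloops (contraction M i₀) ∣)           ≤⟨ s≤s (s≤s boundCon) ⟩
     suc (suc (b + (d' + d')))                           ≡⟨ twoMore b d' ⟩
     b + (suc d' + suc d')                               ∎)
  where
    open ≤-Reasoning
    twoMore : ∀ b d' → suc (suc (b + (d' + d'))) ≡ b + (suc d' + suc d')
    twoMore = solveℕ

glue : ∀ {n} → Family n → Family n → Family (suc n)
glue G H (false ∷ S) = G S
glue G H (true  ∷ S) = H S

families : ∀ n → List (Family n)
families zero    = const true ∷ const false ∷ []
families (suc n) = cartesianProductWith glue (families n) (families n)

families-complete : ∀ n (F : Family n) → Any (λ G → ∀ S → G S ≡ F S) (families n)
families-complete zero F with F [] in e
... | true  = here λ { [] → sym e }
... | false = there (here λ { [] → sym e })
families-complete (suc n) F =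
  cartesianProductWith⁺ glue glued (families-complete n (deletion₀ F)) (families-complete n (link₀ F))
  where
    glued : ∀ {G H} → (∀ S → G S ≡ deletion₀ F S) → (∀ S → H S ≡ link₀ F S) → ∀ S → glue G H S ≡ F S
    glued eG eH (false ∷ S) = eG S
    glued eG eH (true  ∷ S) = eH S

MatroidAxioms : ∀ {n} → Family n → Set
MatroidAxioms F =
  F ∅ ≡ true ×
  (∀ S T → S ⊆ T → F T ≡ true → F S ≡ true) ×
  (∀ S T → F S ≡ true → F T ≡ true → ∣ S ∣ < ∣ T ∣ → ∃ λ x → x ∈ T × x ∉ S × F (S ∪ ⁅ x ⁆) ≡ true)

∀Subset? : ∀ {n} {P : Subset n → Set} → Decidable P → Dec (∀ S → P S)
∀Subset? P? with anySubset? (λ S → ¬? (P? S))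
... | yes (S , ¬PS) = no (λ all → ¬PS (all S))
... | no none       = yes (λ S → decidable-stable (P? S) (λ ¬PS → none (S , ¬PS)))

matroidAxioms? : ∀ {n} (F : Family n) → Dec (MatroidAxioms F)
matroidAxioms? F =
  (F ∅ ≟ᵇ true) ×-dec
  ∀Subset? (λ S → ∀Subset? (λ T → (S ⊆? T) →-dec ((F T ≟ᵇ true) →-dec (F S ≟ᵇ true)))) ×-dec
  ∀Subset? (λ S → ∀Subset? (λ T → (F S ≟ᵇ true) →-dec ((F T ≟ᵇ true) →-dec ((∣ S ∣ <? ∣ T ∣) →-dec
    any? (λ x → (x ∈? T) ×-dec ¬? (x ∈? S) ×-dec (F (S ∪ ⁅ x ⁆) ≟ᵇ true))))))

toMatroid : ∀ {n} (F : Family n) → MatroidAxioms F → Matroid n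
toMatroid F (empty , down , exch) = record
  { indep = F ; indep-empty = empty ; indep-down = λ {S} {T} → down S T ; indep-exch = λ {S} {T} → exch S T }

axioms-of-matroid : ∀ {n} (M : Matroid n) (F : Family n) → (∀ S → F S ≡ indep M S) → MatroidAxioms F
axioms-of-matroid M F e =
  trans (e ∅) (indep-empty M) ,
  (λ S T S⊆T FT → trans (e S) (indep-down M S⊆T (trans (sym (e T)) FT))) ,
  λ S T FS FT lt → transport (indep-exch M (trans (sym (e S)) FS) (trans (sym (e T)) FT) lt)
  where
    transport : ∀ {S T} → (∃ λ x → x ∈ T × x ∉ S × indep M (S ∪ ⁅ x ⁆) ≡ true) →
                ∃ λ x → x ∈ T × x ∉ S × F (S ∪ ⁅ x ⁆) ≡ true
    transport (x , x∈T , x∉S , i) = x , x∈T , x∉S , trans (e _) i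

asMatroid : ∀ {n} → Family n → Maybe SomeMatroid
asMatroid {n} F with matroidAxioms? F
... | yes ax = just (n , toMatroid F ax)
... | no _   = nothing

catalogue : ℕ → List SomeMatroid
catalogue N = concatMap (λ m → mapMaybe asMatroid (families m)) (upTo (suc N))

asMatroid-≅ : ∀ {n} (M : Matroid n) (F : Family n) → (∀ S → F S ≡ indep M S) →
              MaybeAny (λ P → M ≅ proj₂ P) (asMatroid F)
asMatroid-≅ M F e with matroidAxioms? F
... | yes ax  = just (↔-refl , λ S → trans (e S) (cong (indep M) (sym (tabulate∘lookup S))))
... | no ¬ax = ⊥-elim (¬ax (axioms-of-matroid M F e))

catalogue-complete : ∀ N {n} (M : Matroid n) → n ≤ N → Any (λ P → M ≅ proj₂ P) (catalogue N)
catalogue-complete N {n} M n≤N = concatMap⁺ (λ m → mapMaybe asMatroid (families m)) (applyUpTo⁺ (λ m → m) inFamilies (s≤s n≤N))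
  where
    inFamilies : Any (λ P → M ≅ proj₂ P) (mapMaybe asMatroid (families n))
    inFamilies = mapMaybe⁺ asMatroid (families n)
      (map⁺ (anyMap (λ {F} e → asMatroid-≅ M F e) (families-complete n (indep M))))

size-bound : ∀ {n} (M : Matroid n) d k → 1 ≤ k → Loopless M → HasRank M d → hTop M d ≡ + k →
             n ≤ k + (d + d)
size-bound {n} M d k k≥1 loopless hr h≡k with coloop-or-free M d
... | inj₁ (x , c) with trans (sym (coloop⇒h≡0 M hr x c)) (trans (sym (hTop≡hAlt M d)) h≡k)
...   | refl with k≥1
...     | ()
size-bound {n} M d k k≥1 loopless hr h≡k | inj₂ free with free⇒h-bound M hr free
... | c , h , bound with +-injective (trans (sym h) (trans (sym (hTop≡hAlt M d)) h≡k))
...   | refl =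
  begin
    n                    ≡⟨ sym (∣⊤∣≡n n) ⟩
    ∣ ⊤ {n} ∣             ≤⟨ p⊆q⇒∣p∣≤∣q∣ {p = ⊤ {n}} {q = nonloops M} (λ {x} _ → ∈nonloops⁺ M (loopless x)) ⟩
    ∣ nonloops M ∣       ≤⟨ bound ⟩
    c + (d + d)          ≤⟨ +-monoˡ-≤ (d + d) (n≤1+n c) ⟩
    suc c + (d + d)      ∎
  where open ≤-Reasoning

theorem1p1 : ∀ (d k : ℕ) → 1 ≤ d → 1 ≤ k →
    Σ (List SomeMatroid) λ L →
      ∀ {n} (M : Matroid n) → Loopless M → HasRank M d → hTop M d ≡ + k →
        Any (λ (P : SomeMatroid) → M ≅ proj₂ P) L
theorem1p1 d k _ k≥1 =
  catalogue (k + (d + d)) ,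
  λ M loopless hr h≡k → catalogue-complete (k + (d + d)) M (size-bound M d k k≥1 loopless hr h≡k)
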